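{- Let $G$ be a $P_4$-free graph without isolated vertices. If $D$ is a minimum dominating set of $G$ such that $pri(v,D)\cap (V(G)\setminus D)\neq\emptyset$ for all $v\in D$, then $D$ is also a $[1,2]$-set of $G$.
   Context: All graphs are finite, simple and undirected. $N(v)$ is the neighborhood and $N[v]=N(v)\cup\{v\}$ the closed neighborhood of $v$; for $S\subseteq V(G)$, $N[S]=\bigcup_{v\in S}N[v]$. A graph is $P_4$-free if it has no induced subgraph isomorphic to the path $P_4$ on four vertices. A dominating set is a set $D$ with $N[D]=V(G)$; a minimum dominating set is one of minimum cardinality. For $v\in D$, $pri(v,D)=N[v]\setminus N[D\setminus\{v\}]$. A set $S\subseteq V(G)$ is a $[1,2]$-set of $G$ if $1\leq |N(v)\cap S|\leq 2$ for every vertex $v\in V(G)\setminus S$. -}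

module Defs where

open import Data.Nat using (ℕ; _≤_)
open import Data.Bool using (Bool; true; false)
open import Data.Fin using (Fin)
open import Data.Fin.Subset using (Subset; _∈_; _∉_; ∣_∣)
open import Data.Product using (Σ; ∃; _×_; _,_)
open import Data.Empty using (⊥)
open import Relation.Nullary using (¬_)
open import Relation.Binary.PropositionalEquality using (_≡_; _≢_)

record Graph (n : ℕ) : Set where
  field
    adj   : Fin n → Fin n → Bool
    sym   : ∀ u v → adj u v ≡ adj v u
    irrefl : ∀ v → adj v v ≡ false

open Graph public

module _ {n : ℕ} (G : Graph n) where

  Adj : Fin n → Fin n → Set
  Adj u v = adj G u v ≡ true

  InClosedNbhd : Fin n → Fin n → Set
  InClosedNbhd u v = (u ≡ v) ⊎' Adj v u
    where
      open import Data.Sum using () renaming (_⊎_ to _⊎'_)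

  InClosedNbhdSet : Subset n → Fin n → Set
  InClosedNbhdSet S u = ∃ λ v → v ∈ S × InClosedNbhd u v

  NoIsolated : Set
  NoIsolated = ∀ v → ∃ λ u → Adj v u

  InducedP4 : Fin n → Fin n → Fin n → Fin n → Set
  InducedP4 a b c d =
    a ≢ b × a ≢ c × a ≢ d × b ≢ c × b ≢ d × c ≢ d ×
    Adj a b × Adj b c × Adj c d ×
    ¬ Adj a c × ¬ Adj a d × ¬ Adj b d

  P4Free : Set
  P4Free = ∀ a b c d → ¬ InducedP4 a b c d

  Dominating : Subset n → Set
  Dominating D = ∀ u → InClosedNbhdSet D u

  MinimumDominating : Subset n → Set
  MinimumDominating D = Dominating D × (∀ D' → Dominating D' → ∣ D ∣ ≤ ∣ D' ∣)

  remove : Subset n → Fin n → Subset n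
  remove D v = D Data.Vec.[ v ]≔ false
    where import Data.Vec

  -- u ∈ pri(v, D) = N[v] \ N[D \ {v}]
  InPri : Fin n → Subset n → Fin n → Set
  InPri v D u = InClosedNbhd u v × ¬ InClosedNbhdSet (remove D v) u

  nbhdCount : Subset n → Fin n → ℕ
  nbhdCount S v = ∣ Data.Vec.zipWith Data.Bool._∧_ (Data.Vec.tabulate (adj G v)) S ∣
    where import Data.Vec; import Data.Bool

  OneTwoSet : Subset n → Set
  OneTwoSet S = ∀ v → v ∉ S → 1 ≤ nbhdCount S v × nbhdCount S v ≤ 2

-- A vertex v ∉ D has a neighbour in D because D dominates. Suppose it had three. Among
-- three vertices one is adjacent to both others or to neither. If d ∈ D is adjacent
-- to d₁, d₂ ∈ D and p, p₂ are external private neighbours of d, d₂, then d₁ d p p₂ or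
-- p₂ d₂ d p is an induced P4, according as p ~ p₂ or not. If d₃ is adjacent to neither d₁
-- nor d₂, then (D ∖ {d₁, d₂}) ∪ {v} is a smaller dominating set: a vertex w dominated by d₁
-- and by none of v, d₃ would give the induced P4 w d₁ v d₃.
module Submission where

open import Defs
open import Data.Nat using (ℕ; suc; _≤_; _<_; z≤n; s≤s; s≤s⁻¹)
open import Data.Nat.Properties using (≤-refl; ≤-trans; n≤1+n; n<1+n; <⇒≱; ≮⇒≥; module ≤-Reasoning)
open import Data.Bool using (Bool; true)
import Data.Bool.Properties as Bool
open import Data.Fin using (Fin; zero; suc)
import Data.Fin.Properties as Fin
open import Data.Fin.Subset using (Subset; _∈_; _∉_; ∣_∣; _∩_; Nonempty; inside; outside)
open import Data.Fin.Subset.Properties using (x∈p∩q⁺; p∩q⊆p; p∩q⊆q)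
open import Data.Vec using (_∷_; _[_]≔_; tabulate; here; there)
open import Data.Vec.Properties
  using ([]=⇒lookup; lookup⇒[]=; lookup∘tabulate; lookup∘update′; []≔-updates; []≔-minimal; []=-injective)
open import Data.Product using (∃; _×_; _,_; proj₁; proj₂)
open import Data.Sum using (_⊎_; inj₁; inj₂)
open import Data.Empty using (⊥; ⊥-elim)
open import Function using (_∘_)
open import Relation.Nullary using (¬_; yes; no; Dec)
open import Relation.Binary.PropositionalEquality
  using (_≡_; _≢_; refl; trans; cong; subst; ≢-sym) renaming (sym to ≡-sym)

private
  variable
    m : ℕ

x∈tabulate⁺ : ∀ {f : Fin m → Bool} {x} → f x ≡ true → x ∈ tabulate f
x∈tabulate⁺ {f = f} {x} fx = lookup⇒[]= x (tabulate f) (trans (lookup∘tabulate f x) fx)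

x∈tabulate⁻ : ∀ {f : Fin m → Bool} {x} → x ∈ tabulate f → f x ≡ true
x∈tabulate⁻ {f = f} {x} x∈ = trans (≡-sym (lookup∘tabulate f x)) ([]=⇒lookup x∈)

x∈p[y]≔outside⇒x≢y : ∀ {p : Subset m} {x y} → x ∈ p [ y ]≔ outside → x ≢ y
x∈p[y]≔outside⇒x≢y {p = p} {x} x∈ refl with []=-injective ([]≔-updates p x) x∈
... | ()

x∈p[y]≔b⇒x∈p : ∀ {p : Subset m} {x y b} → x ≢ y → x ∈ p [ y ]≔ b → x ∈ p
x∈p[y]≔b⇒x∈p {p = p} {x} {b = b} x≢y x∈ =
  lookup⇒[]= x p (trans (≡-sym (lookup∘update′ x≢y p b)) ([]=⇒lookup x∈))

x∈p⇒suc∣p[x]≔outside∣≡∣p∣ : ∀ {p : Subset m} {x} → x ∈ p → suc ∣ p [ x ]≔ outside ∣ ≡ ∣ p ∣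
x∈p⇒suc∣p[x]≔outside∣≡∣p∣ here = refl
x∈p⇒suc∣p[x]≔outside∣≡∣p∣ {p = inside  ∷ p} (there x∈p) = cong suc (x∈p⇒suc∣p[x]≔outside∣≡∣p∣ x∈p)
x∈p⇒suc∣p[x]≔outside∣≡∣p∣ {p = outside ∷ p} (there x∈p) = x∈p⇒suc∣p[x]≔outside∣≡∣p∣ x∈p

∣p[x]≔inside∣≤suc∣p∣ : ∀ (p : Subset m) x → ∣ p [ x ]≔ inside ∣ ≤ suc ∣ p ∣
∣p[x]≔inside∣≤suc∣p∣ (inside  ∷ p) zero    = n≤1+n _
∣p[x]≔inside∣≤suc∣p∣ (outside ∷ p) zero    = ≤-refl
∣p[x]≔inside∣≤suc∣p∣ (inside  ∷ p) (suc x) = s≤s (∣p[x]≔inside∣≤suc∣p∣ p x)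
∣p[x]≔inside∣≤suc∣p∣ (outside ∷ p) (suc x) = ∣p[x]≔inside∣≤suc∣p∣ p x

1≤∣p∣⇒Nonempty : ∀ (p : Subset m) → 1 ≤ ∣ p ∣ → Nonempty p
1≤∣p∣⇒Nonempty (inside  ∷ p) _   = zero , here
1≤∣p∣⇒Nonempty (outside ∷ p) 1≤∣p∣ with 1≤∣p∣⇒Nonempty p 1≤∣p∣
... | x , x∈p = suc x , there x∈p

x∈p⇒1≤∣p∣ : ∀ {p : Subset m} {x} → x ∈ p → 1 ≤ ∣ p ∣
x∈p⇒1≤∣p∣ x∈p = subst (1 ≤_) (x∈p⇒suc∣p[x]≔outside∣≡∣p∣ x∈p) (s≤s z≤n)

removeMember : ∀ {k} (p : Subset m) → suc k ≤ ∣ p ∣ → ∃ λ x → x ∈ p × k ≤ ∣ p [ x ]≔ outside ∣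
removeMember {k = k} p k<∣p∣ with 1≤∣p∣⇒Nonempty p (≤-trans (s≤s z≤n) k<∣p∣)
... | x , x∈p = x , x∈p , s≤s⁻¹ (subst (suc k ≤_) (≡-sym (x∈p⇒suc∣p[x]≔outside∣≡∣p∣ x∈p)) k<∣p∣)

record ThreeMembers (p : Subset m) : Set where
  field
    {x y z} : Fin m
    x∈p     : x ∈ p
    y∈p     : y ∈ p
    z∈p     : z ∈ p
    y≢x     : y ≢ x
    z≢x     : z ≢ x
    z≢y     : z ≢ y

3≤∣p∣⇒ThreeMembers : ∀ (p : Subset m) → 3 ≤ ∣ p ∣ → ThreeMembers p
3≤∣p∣⇒ThreeMembers p 3≤∣p∣ with removeMember p 3≤∣p∣
... | x , x∈p , 2≤∣p-x∣ with removeMember (p [ x ]≔ outside) 2≤∣p-x∣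
... | y , y∈p-x , 1≤∣p-x-y∣ with 1≤∣p∣⇒Nonempty _ 1≤∣p-x-y∣
... | z , z∈p-x-y = record
  { x∈p = x∈p
  ; y∈p = x∈p[y]≔b⇒x∈p y≢x y∈p-x
  ; z∈p = x∈p[y]≔b⇒x∈p z≢x z∈p-x
  ; y≢x = y≢x
  ; z≢x = z≢x
  ; z≢y = z≢y
  }
  where
  y≢x : y ≢ x
  y≢x = x∈p[y]≔outside⇒x≢y y∈p-x
  z≢y : z ≢ y
  z≢y = x∈p[y]≔outside⇒x≢y z∈p-x-y
  z∈p-x : z ∈ p [ x ]≔ outside
  z∈p-x = x∈p[y]≔b⇒x∈p z≢y z∈p-x-y
  z≢x : z ≢ x
  z≢x = x∈p[y]≔outside⇒x≢y z∈p-x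

module _ {n : ℕ} (G : Graph n) where

  Adj-sym : ∀ {u v} → Adj G u v → Adj G v u
  Adj-sym {u} {v} uv = trans (Graph.sym G v u) uv

  Adj⇒≢ : ∀ {u v} → Adj G u v → u ≢ v
  Adj⇒≢ {u} uu refl with trans (≡-sym uu) (irrefl G u)
  ... | ()

  Adj? : ∀ u v → Dec (Adj G u v)
  Adj? u v = adj G u v Bool.≟ true

  inducedP4 : ∀ {a b c d} → Adj G a b → Adj G b c → Adj G c d →
              ¬ Adj G a c → ¬ Adj G a d → ¬ Adj G b d → InducedP4 G a b c d
  inducedP4 ab bc cd ¬ac ¬ad ¬bd =
    Adj⇒≢ ab , (λ { refl → ¬ad cd }) , (λ { refl → ¬bd (Adj-sym ab) }) ,
    Adj⇒≢ bc , (λ { refl → ¬ad ab }) , Adj⇒≢ cd ,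
    ab , bc , cd , ¬ac , ¬ad , ¬bd

  nbhd : Fin n → Subset n
  nbhd v = tabulate (adj G v)

  x∈nbhd∩S⁺ : ∀ {S v x} → Adj G v x → x ∈ S → x ∈ nbhd v ∩ S
  x∈nbhd∩S⁺ vx x∈S = x∈p∩q⁺ (x∈tabulate⁺ vx , x∈S)

  x∈nbhd∩S⁻ : ∀ {S v x} → x ∈ nbhd v ∩ S → Adj G v x × x ∈ S
  x∈nbhd∩S⁻ {S} {v} x∈ = x∈tabulate⁻ (p∩q⊆p (nbhd v) S x∈) , p∩q⊆q (nbhd v) S x∈

  ExternalPrivateNeighbour : Subset n → Fin n → Fin n → Set
  ExternalPrivateNeighbour D d p = Adj G d p × p ∉ D × (∀ {e} → e ∈ D → e ≢ d → ¬ Adj G e p)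

  InPri⇒ExternalPrivateNeighbour : ∀ {D d p} → d ∈ D → InPri G d D p → p ∉ D →
                                   ExternalPrivateNeighbour D d p
  InPri⇒ExternalPrivateNeighbour d∈D (inj₁ refl , _) p∉D with p∉D d∈D
  ... | ()
  InPri⇒ExternalPrivateNeighbour {D} {d} d∈D (inj₂ dp , ¬dominated) p∉D =
    dp , p∉D , λ {e} e∈D e≢d ep → ¬dominated (e , []≔-minimal D e d e≢d e∈D , inj₂ ep)

  Dominating⇒1≤nbhdCount : ∀ {D v} → Dominating G D → v ∉ D → 1 ≤ nbhdCount G D v
  Dominating⇒1≤nbhdCount {D} {v} dom v∉D with dom v
  ... | x , x∈D , inj₁ refl = ⊥-elim (v∉D x∈D)
  ... | x , x∈D , inj₂ xv   = x∈p⇒1≤∣p∣ (x∈nbhd∩S⁺ {D} (Adj-sym xv) x∈D)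

  exchange : Subset n → Fin n → Fin n → Fin n → Subset n
  exchange D d₁ d₂ v = remove G (remove G D d₁) d₂ [ v ]≔ inside

  x∈exchange : ∀ {D d₁ d₂ v x} → x ∈ D → x ≢ d₁ → x ≢ d₂ → x ≢ v → x ∈ exchange D d₁ d₂ v
  x∈exchange {D} {d₁} {d₂} {v} {x} x∈D x≢d₁ x≢d₂ x≢v =
    []≔-minimal _ x v x≢v ([]≔-minimal _ x d₂ x≢d₂ ([]≔-minimal D x d₁ x≢d₁ x∈D))

  ∣exchange∣<∣D∣ : ∀ {D d₁ d₂} v → d₁ ∈ D → d₂ ∈ D → d₂ ≢ d₁ → ∣ exchange D d₁ d₂ v ∣ < ∣ D ∣
  ∣exchange∣<∣D∣ {D} {d₁} {d₂} v d₁∈D d₂∈D d₂≢d₁ = begin-strict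
    ∣ exchange D d₁ d₂ v ∣           ≤⟨ ∣p[x]≔inside∣≤suc∣p∣ D₁₂ v ⟩
    suc ∣ D₁₂ ∣                      <⟨ n<1+n _ ⟩
    suc (suc ∣ D₁₂ ∣)                ≡⟨ cong suc (x∈p⇒suc∣p[x]≔outside∣≡∣p∣ ([]≔-minimal D d₂ d₁ d₂≢d₁ d₂∈D)) ⟩
    suc ∣ remove G D d₁ ∣            ≡⟨ x∈p⇒suc∣p[x]≔outside∣≡∣p∣ d₁∈D ⟩
    ∣ D ∣                            ∎
    where
    open ≤-Reasoning
    D₁₂ : Subset n
    D₁₂ = remove G (remove G D d₁) d₂

  module _ (p4free : P4Free G) where

    N[d]⊆N[v]∪N[d′] : ∀ {d v d′ w} → Adj G v d → Adj G v d′ → ¬ Adj G d d′ →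
                      InClosedNbhd G w d → InClosedNbhd G w v ⊎ InClosedNbhd G w d′
    N[d]⊆N[v]∪N[d′] vd vd′ ¬dd′ (inj₁ refl) = inj₁ (inj₂ vd)
    N[d]⊆N[v]∪N[d′] {d} {v} {d′} {w} vd vd′ ¬dd′ (inj₂ dw) with Adj? v w | Adj? d′ w
    ... | yes vw | _        = inj₁ (inj₂ vw)
    ... | no _   | yes d′w  = inj₂ (inj₂ d′w)
    ... | no ¬vw | no ¬d′w  = ⊥-elim (p4free w d v d′
      (inducedP4 (Adj-sym dw) (Adj-sym vd) vd′ (¬vw ∘ Adj-sym) (¬d′w ∘ Adj-sym) ¬dd′))

    exchange-Dominating : ∀ {D v d₁ d₂ d₃} → Dominating G D → v ∉ D → d₃ ∈ D → d₃ ≢ d₁ → d₃ ≢ d₂ →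
                          Adj G v d₁ → Adj G v d₂ → Adj G v d₃ → ¬ Adj G d₁ d₃ → ¬ Adj G d₂ d₃ →
                          Dominating G (exchange D d₁ d₂ v)
    exchange-Dominating {D} {v} {d₁} {d₂} {d₃} dom v∉D d₃∈D d₃≢d₁ d₃≢d₂ vd₁ vd₂ vd₃ ¬d₁d₃ ¬d₂d₃ w =
      redominate (dom w)
      where
      D′ : Subset n
      D′ = exchange D d₁ d₂ v

      ∈D⇒≢v : ∀ {x} → x ∈ D → x ≢ v
      ∈D⇒≢v x∈D refl = v∉D x∈D

      viaNeighbour : ∀ {d} → Adj G v d → ¬ Adj G d d₃ → InClosedNbhd G w d → InClosedNbhdSet G D′ w
      viaNeighbour vd ¬dd₃ w∈N[d] with N[d]⊆N[v]∪N[d′] vd vd₃ ¬dd₃ w∈N[d]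
      ... | inj₁ w∈N[v]  = v , []≔-updates _ v , w∈N[v]
      ... | inj₂ w∈N[d₃] = d₃ , x∈exchange d₃∈D d₃≢d₁ d₃≢d₂ (∈D⇒≢v d₃∈D) , w∈N[d₃]

      redominate : InClosedNbhdSet G D w → InClosedNbhdSet G D′ w
      redominate (x , x∈D , w∈N[x]) with x Fin.≟ d₁ | x Fin.≟ d₂
      ... | yes refl | _        = viaNeighbour vd₁ ¬d₁d₃ w∈N[x]
      ... | no _     | yes refl = viaNeighbour vd₂ ¬d₂d₃ w∈N[x]
      ... | no x≢d₁  | no x≢d₂  = x , x∈exchange x∈D x≢d₁ x≢d₂ (∈D⇒≢v x∈D) , w∈N[x]

    privateNeighbours⇒¬Adj : ∀ {D d d₁ d₂} → d ∈ D → d₁ ∈ D → d₂ ∈ D → d₁ ≢ d → d₂ ≢ d → d₁ ≢ d₂ →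
                             ∃ (ExternalPrivateNeighbour D d) → ∃ (ExternalPrivateNeighbour D d₂) →
                             Adj G d d₁ → ¬ Adj G d d₂
    privateNeighbours⇒¬Adj {d = d} {d₁} {d₂} d∈D d₁∈D d₂∈D d₁≢d d₂≢d d₁≢d₂
                           (p , dp , _ , excl) (p₂ , d₂p₂ , _ , excl₂) dd₁ dd₂ with Adj? p p₂
    ... | yes pp₂ = p4free d₁ d p p₂ (inducedP4 (Adj-sym dd₁) dp pp₂
                      (excl d₁∈D d₁≢d) (excl₂ d₁∈D d₁≢d₂) (excl₂ d∈D (≢-sym d₂≢d)))
    ... | no ¬pp₂ = p4free p₂ d₂ d p (inducedP4 (Adj-sym d₂p₂) (Adj-sym dd₂) dp
                      (excl₂ d∈D (≢-sym d₂≢d) ∘ Adj-sym) (¬pp₂ ∘ Adj-sym) (excl d₂∈D d₂≢d))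

    minimum⇒¬exchangeable : ∀ {D v d₁ d₂ d₃} → MinimumDominating G D → v ∉ D →
                            d₁ ∈ D → d₂ ∈ D → d₃ ∈ D → d₂ ≢ d₁ → d₃ ≢ d₁ → d₃ ≢ d₂ →
                            Adj G v d₁ → Adj G v d₂ → Adj G v d₃ → ¬ Adj G d₁ d₃ → ¬ Adj G d₂ d₃ → ⊥
    minimum⇒¬exchangeable (dom , minimum) v∉D d₁∈D d₂∈D d₃∈D d₂≢d₁ d₃≢d₁ d₃≢d₂ vd₁ vd₂ vd₃ ¬d₁d₃ ¬d₂d₃ =
      <⇒≱ (∣exchange∣<∣D∣ _ d₁∈D d₂∈D d₂≢d₁)
          (minimum _ (exchange-Dominating dom v∉D d₃∈D d₃≢d₁ d₃≢d₂ vd₁ vd₂ vd₃ ¬d₁d₃ ¬d₂d₃))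

    noThreeDNeighbours : ∀ {D v} → MinimumDominating G D →
                         (∀ {d} → d ∈ D → ∃ (ExternalPrivateNeighbour D d)) →
                         v ∉ D → ¬ ThreeMembers (nbhd v ∩ D)
    noThreeDNeighbours {D} {v} minimum externalPrivate v∉D three =
      triangle (Adj? x y) (Adj? x z) (Adj? y z)
      where
      open ThreeMembers three

      inD : ∀ {a} → a ∈ nbhd v ∩ D → a ∈ D
      inD a∈ = proj₂ (x∈nbhd∩S⁻ a∈)

      inN : ∀ {a} → a ∈ nbhd v ∩ D → Adj G v a
      inN a∈ = proj₁ (x∈nbhd∩S⁻ a∈)

      centre : ∀ {a b c} → a ∈ nbhd v ∩ D → b ∈ nbhd v ∩ D → c ∈ nbhd v ∩ D →
               b ≢ a → c ≢ a → b ≢ c → Adj G a b → ¬ Adj G a c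
      centre a∈ b∈ c∈ b≢a c≢a b≢c = privateNeighbours⇒¬Adj (inD a∈) (inD b∈) (inD c∈) b≢a c≢a b≢c
        (externalPrivate (inD a∈)) (externalPrivate (inD c∈))

      leaf : ∀ {a b c} → a ∈ nbhd v ∩ D → b ∈ nbhd v ∩ D → c ∈ nbhd v ∩ D →
             b ≢ a → c ≢ a → c ≢ b → ¬ Adj G a c → ¬ Adj G b c → ⊥
      leaf a∈ b∈ c∈ b≢a c≢a c≢b = minimum⇒¬exchangeable minimum v∉D (inD a∈) (inD b∈) (inD c∈)
        b≢a c≢a c≢b (inN a∈) (inN b∈) (inN c∈)

      triangle : Dec (Adj G x y) → Dec (Adj G x z) → Dec (Adj G y z) → ⊥
      triangle (yes xy) (yes xz) _        = centre x∈p y∈p z∈p y≢x z≢x (≢-sym z≢y) xy xz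
      triangle (yes xy) (no _)   (yes yz) = centre y∈p x∈p z∈p (≢-sym y≢x) z≢y (≢-sym z≢x) (Adj-sym xy) yz
      triangle (yes _)  (no ¬xz) (no ¬yz) = leaf x∈p y∈p z∈p y≢x z≢x z≢y ¬xz ¬yz
      triangle (no _)   (yes xz) (yes yz) =
        centre z∈p x∈p y∈p (≢-sym z≢x) (≢-sym z≢y) (≢-sym y≢x) (Adj-sym xz) (Adj-sym yz)
      triangle (no ¬xy) (yes _)  (no ¬yz) = leaf x∈p z∈p y∈p z≢x y≢x (≢-sym z≢y) ¬xy (¬yz ∘ Adj-sym)
      triangle (no ¬xy) (no ¬xz) _        =
        leaf y∈p z∈p x∈p z≢y (≢-sym y≢x) (≢-sym z≢x) (¬xy ∘ Adj-sym) (¬xz ∘ Adj-sym)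

theorem4p4 : (n : ℕ) (G : Graph n) → P4Free G → NoIsolated G →
    (D : Subset n) → MinimumDominating G D →
    (∀ v → v ∈ D → ∃ λ u → InPri G v D u × u ∉ D) →
    OneTwoSet G D
theorem4p4 n G p4free _ D minimum hasPrivate v v∉D =
  Dominating⇒1≤nbhdCount G (proj₁ minimum) v∉D ,
  ≮⇒≥ λ 3≤count → noThreeDNeighbours G p4free minimum externalPrivate v∉D (3≤∣p∣⇒ThreeMembers _ 3≤count)
  where
  externalPrivate : ∀ {d} → d ∈ D → ∃ (ExternalPrivateNeighbour G D d)
  externalPrivate d∈D with hasPrivate _ d∈D
  ... | p , p∈pri , p∉D = p , InPri⇒ExternalPrivateNeighbour G d∈D p∈pri p∉D
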